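{- For any integers $m,n$ with $1<m\le n/2$, the sequence $B'(m,n)$ is a permutation of $\{1,\dots,n\}$.
   Context: For an integer $N\ge1$, $L(N)$ is the decreasing sequence of the elements of $\{1,\dots,N\}\setminus\{\lceil N/2\rceil\}$ (length $N-1$). $I(\sigma)$ adds $1$ to every entry of $\sigma$, $I^k$ is its $k$-fold iterate, and $\oplus$ is concatenation. For $1<m\le n/2$, $B'(m,n)=(\lceil (n+m)/2\rceil)\oplus I(L(m-1))\oplus(1)\oplus I^{m}(L(n-m))\oplus(\lfloor m/2\rfloor+1)$. -}

module Defs where

open import Data.Nat using (ℕ; zero; suc; _+_; _∸_; _≟_; _/_)
open import Data.List using (List; []; _∷_; _++_; map; filter; applyUpTo)
open import Relation.Nullary using (¬?)

⌈_/2⌉ : ℕ → ℕ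
⌈ N /2⌉ = (N + 1) / 2

⌊_/2⌋ : ℕ → ℕ
⌊ N /2⌋ = N / 2

dec : ℕ → List ℕ
dec zero    = []
dec (suc k) = suc k ∷ dec k

oneTo : ℕ → List ℕ
oneTo n = applyUpTo suc n

L : ℕ → List ℕ
L N = filter (λ x → ¬? (x ≟ ⌈ N /2⌉)) (dec N)

Iter : ℕ → List ℕ → List ℕ
Iter k = map (k +_)

I : List ℕ → List ℕ
I = Iter 1

B′ : ℕ → ℕ → List ℕ
B′ m n = (⌈ (n + m) /2⌉ ∷ []) ++ I (L (m ∸ 1)) ++ (1 ∷ []) ++ Iter m (L (n ∸ m)) ++ ((⌊ m /2⌋ + 1) ∷ [])

-- With m = p + 1 and n = m + q, the list n, n-1, …, 1 splits as I^m(q, …, 1) ++ I(p, …, 1) ++ (1).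
-- Pulling the middle element ⌈q/2⌉ resp. ⌈p/2⌉ to the front of each decreasing block turns the two
-- blocks into I^m(L q) and I(L p), and the two extracted entries are exactly the first and last
-- entries of B′(m, n): m + ⌈q/2⌉ = ⌈(n + m)/2⌉ and 1 + ⌈p/2⌉ = ⌊m/2⌋ + 1.
module Submission where

open import Defs
open import Data.Nat using (ℕ; _<_; _≤_; _*_; zero; suc; _+_; _≟_; _/_; s≤s; z≤n)
open import Data.Nat.Properties
open import Data.Nat.DivMod using (m/n≡1+[m∸n]/n; m/n≤m; m*n/n≡m; +-distrib-/-∣ʳ)
open import Data.Nat.Divisibility using (divides-refl)
open import Data.List using (List; _∷_; _++_; filter; [_])
open import Data.List.Properties using (applyUpTo-∷ʳ; filter-accept; filter-reject; ++-assoc)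
open import Data.List.Relation.Binary.Permutation.Propositional
  using (_↭_; ↭-sym; ↭-reflexive; prep; swap; refl; module PermutationReasoning)
open import Data.List.Relation.Binary.Permutation.Propositional.Properties using (++-comm; map⁺; ++⁺; ++⁺ʳ)
open import Data.Product using (_,_)
open import Relation.Nullary using (¬?; yes; no)
open import Relation.Binary.PropositionalEquality using (_≡_; cong; sym; trans; module ≡-Reasoning)
  renaming (refl to ≡-refl)
open import Data.Empty using (⊥-elim)
open import Data.Nat.Tactic.RingSolver using (solve-∀)

without : ℕ → List ℕ → List ℕ
without c = filter (λ x → ¬? (x ≟ c))

without-dec-< : ∀ c N → N < c → without c (dec N) ≡ dec N
without-dec-< c zero    N<c = ≡-refl
without-dec-< c (suc N) N<c with suc N ≟ c
... | yes N≡c = ⊥-elim (<-irrefl N≡c N<c)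
... | no  N≢c = trans (filter-accept (λ x → ¬? (x ≟ c)) N≢c)
                      (cong (suc N ∷_) (without-dec-< c N (<-trans (n<1+n N) N<c)))

without-dec-suc : ∀ N → without (suc N) (dec (suc N)) ≡ dec N
without-dec-suc N = trans (filter-reject (λ x → ¬? (x ≟ suc N)) (λ N≢N → N≢N ≡-refl))
                          (without-dec-< (suc N) N (n<1+n N))

dec-↭-∷-without : ∀ c N → 1 ≤ c → c ≤ N → dec N ↭ c ∷ without c (dec N)
dec-↭-∷-without c zero    1≤c c≤0 = ⊥-elim (<-irrefl ≡-refl (≤-trans 1≤c c≤0))
dec-↭-∷-without c (suc N) 1≤c c≤N with suc N ≟ c
... | yes ≡-refl = prep (suc N) (↭-reflexive (sym (without-dec-suc N)))
... | no  N≢c = begin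
        suc N ∷ dec N                 ↭⟨ prep (suc N) (dec-↭-∷-without c N 1≤c c≤N′) ⟩
        suc N ∷ c ∷ without c (dec N) ↭⟨ swap (suc N) c refl ⟩
        c ∷ suc N ∷ without c (dec N) ≡⟨ cong (c ∷_) (sym (filter-accept (λ x → ¬? (x ≟ c)) N≢c)) ⟩
        c ∷ without c (dec (suc N))   ∎
  where
  open PermutationReasoning
  c≤N′ : c ≤ N
  c≤N′ = ≤-pred (≤∧≢⇒< c≤N (λ c≡N → N≢c (sym c≡N)))

oneTo-↭-dec : ∀ n → oneTo n ↭ dec n
oneTo-↭-dec zero    = refl
oneTo-↭-dec (suc n) = begin
  oneTo (suc n)        ≡⟨ sym (applyUpTo-∷ʳ suc n) ⟩
  oneTo n ++ [ suc n ] ↭⟨ ++-comm (oneTo n) [ suc n ] ⟩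
  suc n ∷ oneTo n      ↭⟨ prep (suc n) (oneTo-↭-dec n) ⟩
  dec (suc n)          ∎
  where open PermutationReasoning

dec-+ : ∀ a b → dec (a + b) ≡ Iter a (dec b) ++ dec a
dec-+ a zero    rewrite +-identityʳ a = ≡-refl
dec-+ a (suc b) rewrite +-suc a b     = cong (suc (a + b) ∷_) (dec-+ a b)

⌈suc/2⌉≡suc⌊/2⌋ : ∀ k → ⌈ suc k /2⌉ ≡ suc ⌊ k /2⌋
⌈suc/2⌉≡suc⌊/2⌋ k = trans (cong (_/ 2) (+-comm (suc k) 1)) (m/n≡1+[m∸n]/n {suc (suc k)} (s≤s (s≤s z≤n)))

⌊suc/2⌋≡⌈/2⌉ : ∀ k → ⌊ suc k /2⌋ ≡ ⌈ k /2⌉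
⌊suc/2⌋≡⌈/2⌉ k = cong (_/ 2) (+-comm 1 k)

⌈a+q+a/2⌉≡a+⌈q/2⌉ : ∀ a q → ⌈ a + q + a /2⌉ ≡ a + ⌈ q /2⌉
⌈a+q+a/2⌉≡a+⌈q/2⌉ a q = begin
  (a + q + a + 1) / 2  ≡⟨ cong (_/ 2) (regroup a q) ⟩
  (q + 1 + a * 2) / 2  ≡⟨ +-distrib-/-∣ʳ (q + 1) (divides-refl a) ⟩
  ⌈ q /2⌉ + a * 2 / 2  ≡⟨ cong (⌈ q /2⌉ +_) (m*n/n≡m a 2) ⟩
  ⌈ q /2⌉ + a          ≡⟨ +-comm ⌈ q /2⌉ a ⟩
  a + ⌈ q /2⌉          ∎
  where
  open ≡-Reasoning
  regroup : ∀ a q → a + q + a + 1 ≡ q + 1 + a * 2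
  regroup = solve-∀

dec-↭-∷-L : ∀ N → 1 ≤ N → dec N ↭ ⌈ N /2⌉ ∷ L N
dec-↭-∷-L (suc k) _ = dec-↭-∷-without ⌈ suc k /2⌉ (suc k) 1≤⌈N/2⌉ ⌈N/2⌉≤N
  where
  1≤⌈N/2⌉ : 1 ≤ ⌈ suc k /2⌉
  1≤⌈N/2⌉ = ≤-trans (s≤s z≤n) (≤-reflexive (sym (⌈suc/2⌉≡suc⌊/2⌋ k)))
  ⌈N/2⌉≤N : ⌈ suc k /2⌉ ≤ suc k
  ⌈N/2⌉≤N = ≤-trans (≤-reflexive (⌈suc/2⌉≡suc⌊/2⌋ k)) (s≤s (m/n≤m k 2))

swap-blocks : ∀ (x y : ℕ) (as cs : List ℕ) →
                x ∷ as ++ 1 ∷ cs ++ [ y ] ↭ (x ∷ cs) ++ (y ∷ as) ++ [ 1 ]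
swap-blocks x y as cs = prep x (begin
  as ++ 1 ∷ cs ++ [ y ]    ↭⟨ ++-comm as (1 ∷ cs ++ [ y ]) ⟩
  1 ∷ (cs ++ [ y ]) ++ as  ≡⟨ cong (1 ∷_) (++-assoc cs [ y ] as) ⟩
  [ 1 ] ++ cs ++ y ∷ as    ↭⟨ ++-comm [ 1 ] (cs ++ y ∷ as) ⟩
  (cs ++ y ∷ as) ++ [ 1 ]  ≡⟨ ++-assoc cs (y ∷ as) [ 1 ] ⟩
  cs ++ (y ∷ as) ++ [ 1 ]  ∎)
  where open PermutationReasoning

B′-≡ : ∀ p q → B′ (suc p) (suc p + q)
               ≡ (suc p + ⌈ q /2⌉) ∷ I (L p) ++ 1 ∷ Iter (suc p) (L q) ++ [ 1 + ⌈ p /2⌉ ]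
B′-≡ p q rewrite ⌈a+q+a/2⌉≡a+⌈q/2⌉ (suc p) q | m+n∸m≡n (suc p) q
               | ⌊suc/2⌋≡⌈/2⌉ p | +-comm ⌈ p /2⌉ 1 = ≡-refl

B′-↭-oneTo : ∀ p q → 1 ≤ p → 1 ≤ q → B′ (suc p) (suc p + q) ↭ oneTo (suc p + q)
B′-↭-oneTo p q 1≤p 1≤q = begin
  B′ m (m + q)
    ≡⟨ B′-≡ p q ⟩
  (m + ⌈ q /2⌉) ∷ I (L p) ++ 1 ∷ Iter m (L q) ++ [ 1 + ⌈ p /2⌉ ]
    ↭⟨ swap-blocks _ _ (I (L p)) (Iter m (L q)) ⟩
  Iter m (⌈ q /2⌉ ∷ L q) ++ I (⌈ p /2⌉ ∷ L p) ++ [ 1 ]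
    ↭⟨ ↭-sym (++⁺ (map⁺ (m +_) (dec-↭-∷-L q 1≤q)) (++⁺ʳ [ 1 ] (map⁺ (1 +_) (dec-↭-∷-L p 1≤p)))) ⟩
  Iter m (dec q) ++ Iter 1 (dec p) ++ dec 1
    ≡⟨ sym (cong (Iter m (dec q) ++_) (dec-+ 1 p)) ⟩
  Iter m (dec q) ++ dec m
    ≡⟨ sym (dec-+ m q) ⟩
  dec (m + q)
    ↭⟨ ↭-sym (oneTo-↭-dec (m + q)) ⟩
  oneTo (m + q) ∎
  where
  open PermutationReasoning
  m : ℕ
  m = suc p

lemma3p9 : ∀ (m n : ℕ) → 1 < m → 2 * m ≤ n → B′ m n ↭ oneTo n
lemma3p9 (suc p) n (s≤s 1≤p) 2m≤n with m≤n⇒∃[o]m+o≡n (≤-trans (m≤m+n (suc p) (suc p + 0)) 2m≤n)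
... | q , ≡-refl = B′-↭-oneTo p q 1≤p (≤-trans (s≤s z≤n) m≤q)
  where
  m≤q : suc p ≤ q
  m≤q = +-cancelˡ-≤ (suc p) (suc p) q (≤-trans (≤-reflexive (cong (suc p +_) (sym (+-identityʳ (suc p))))) 2m≤n)
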